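{- Let $P$ be a locally finite poset, let $I,J$ be finite order ideals of $P$, and let $O$ be a $\mathbb T$-labelling of $P$. Then \[ K_{I\wedge_{J(P)}J,O}\,K_{I\vee_{J(P)}J,O}-K_{I,O}\,K_{J,O} \] is monomial-positive, where $I\wedge_{J(P)}J=I\cap J$ and $I\vee_{J(P)}J=I\cup J$ are the meet and join in the lattice $J(P)$ of finite order ideals of $P$.
   Context: Let $\mathbb P=\{1,2,\dots\}$; $s\lessdot t$ means $t$ covers $s$. $\mathbb T$ is the set of weakly increasing functions $\mathbb P\to\mathbb Z\cup\{\infty\}$; a $\mathbb T$-labelling $O$ of $P$ assigns $O(s,t)\in\mathbb T$ to each covering pair $s\lessdot t$. An order ideal is a subset $I$ with $s\in I$, $t\le s$ implying $t\in I$. For a finite order ideal (or finite convex subset) $Q$, a $(Q,O)$-tableau is a map $\tau:Q\to\mathbb P$ with $\tau(s)\le O(s,t)(\tau(t))$ for every covering pair $s\lessdot t$ with $s,t\in Q$, and $K_{Q,O}=\sum_\tau\prod_{i\ge1}x_i^{\#\tau^{ -1}(i)}$ summed over all $(Q,O)$-tableaux. A formal power series is monomial-positive if all its coefficients are nonnegative. -}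

module Defs where

open import Data.Nat using (ℕ; _≤_; _≟_)
open import Data.Integer using (ℤ; +_) renaming (_≤_ to _≤ℤ_)
open import Data.Fin using (Fin)
open import Data.Vec using (Vec; lookup; count)
open import Data.List using (List; length)
import Data.List as L
open import Data.List.Membership.Propositional using (_∈_)
open import Data.Product using (Σ; ∃; _×_)
open import Data.Unit using (⊤)
open import Data.Empty using (⊥)
open import Relation.Nullary using (¬_)
open import Relation.Binary.PropositionalEquality using (_≡_; _≢_)
open import Function.Bundles using (_↔_)

data ℤ∞ : Set where
  fin : ℤ → ℤ∞
  ∞   : ℤ∞

data _≤∞_ : ℤ∞ → ℤ∞ → Set where
  fin≤fin : ∀ {a b} → a ≤ℤ b → fin a ≤∞ fin b
  _≤∞∞    : ∀ a → a ≤∞ ∞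

_≤ℙ∞_ : ℕ → ℤ∞ → Set
n ≤ℙ∞ fin z = + n ≤ℤ z
n ≤ℙ∞ ∞     = ⊤

-- 𝕋 : weakly increasing functions ℙ → ℤ ∪ {∞}.
-- Functions are given on ℕ; only arguments ≥ 1 (i.e. ℙ) matter.
record 𝕋 : Set where
  field
    fun  : ℕ → ℤ∞
    mono : ∀ m n → 1 ≤ m → m ≤ n → fun m ≤∞ fun n
open 𝕋 public

module _ {X : Set} (_≼_ : X → X → Set) where

  _≺_ : X → X → Set
  s ≺ t = (s ≼ t) × (s ≢ t)

  _⋖_ : X → X → Set
  s ⋖ t = (s ≺ t) × (∀ u → s ≺ u → u ≺ t → ⊥)

  LocallyFinite : Set
  LocallyFinite = ∀ s t → ∃ λ (xs : List X) → ∀ u → s ≼ u → u ≼ t → u ∈ xs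

  Labelling : Set
  Labelling = (s t : X) → s ⋖ t → 𝕋

  -- a finite subset is represented by a duplicate-free list of its elements;
  -- it is an order ideal if it is down-closed
  IsOrderIdeal : List X → Set
  IsOrderIdeal I = ∀ s t → s ∈ I → t ≼ s → t ∈ I

  module _ (O : Labelling) where

    -- tableau condition for values v (v i = τ(Q[i])) on the finite set Q:
    -- values are in ℙ, and τ(s) ≤ O(s,t)(τ(t)) for all covering pairs s ⋖ t in Q
    IsTableau : (Q : List X) → Vec ℕ (length Q) → Set
    IsTableau Q v =
      (∀ i → 1 ≤ lookup v i) ×
      (∀ i j → (c : L.lookup Q i ⋖ L.lookup Q j) →
         lookup v i ≤ℙ∞ fun (O (L.lookup Q i) (L.lookup Q j) c) (lookup v j))

    record Tableau (Q : List X) : Set where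
      constructor tab
      field
        val  : Vec ℕ (length Q)
        .ok  : IsTableau Q val

    mult : ∀ {Q} → Tableau Q → ℕ → ℕ
    mult τ i = count (_≟ i) (Tableau.val τ)

    -- pairs (σ,τ) of a (A,O)-tableau and a (B,O)-tableau contributing to the
    -- monomial x^α = ∏_{i≥1} x_i^{α i} in the product K_{A,O} K_{B,O}
    record ProductTerm (A B : List X) (α : ℕ → ℕ) : Set where
      constructor pair
      field
        left    : Tableau A
        right   : Tableau B
        .content : ∀ i → 1 ≤ i → mult left i Data.Nat.+ mult right i ≡ α i

    -- the coefficient of x^α in K_{A,O} K_{B,O} equals n
    ProductCoeff : (A B : List X) → (ℕ → ℕ) → ℕ → Set
    ProductCoeff A B α n = ProductTerm A B α ↔ Fin n

{-# OPTIONS --safe #-}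
module Submission where

-- Given an (I,O)-tableau σ and a (J,O)-tableau τ, fill I ∩ J with σ and I ∪ J with σ on I ∖ J
-- and τ on J, except on a region R ⊆ I ∩ J where the two values at each point are exchanged.
-- R is the least set the tableau conditions force: it contains every point of I ∩ J whose τ-value
-- violates the condition towards the σ-value of a cover in I ∖ J, and it spreads along covers
-- inside I ∩ J whose endpoints cannot be exchanged separately.  Minimality of R together with
-- σ < τ on R makes the new pair a pair of tableaux; the values at each point are merely permuted,
-- so the content is kept; and R can be recomputed from the new pair, so the map is injective.
-- Membership in I, J and R is not decidable for an arbitrary X, but n ≤ m is, so the argument
-- runs under a double negation, where the finitely many decisions it needs are available.

open import Defs hiding (_⋖_)
import Defs
open import Data.Nat using (ℕ; zero; suc; _≤_; _<_; _≟_; _≤?_; _+_)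
open import Data.List using (List; []; _∷_; length; lookup; allFin)
open import Data.List.Membership.Propositional using (_∈_; _∉_)
open import Data.List.Relation.Unary.Unique.Propositional using (Unique)
open import Data.Product using (_×_; _,_; proj₁; proj₂; swap)
open import Data.Sum using (_⊎_; inj₁; inj₂; [_,_]′)
open import Relation.Binary.PropositionalEquality
  using (_≡_; _≢_; refl; sym; trans; cong; cong₂; subst; subst₂; module ≡-Reasoning)
open import Relation.Binary.Structures using (IsPartialOrder)
open import Function.Bundles using (_⇔_; _↔_; _↣_; Equivalence; Injection; Inverse; mk↣)

open import Data.Nat.Properties using (+-comm; +-identityʳ; <⇒≤; ≰⇒>; +-0-commutativeMonoid)
open import Algebra.Properties.CommutativeMonoid.Sum +-0-commutativeMonoid
  using (sum; sum-remove; sum-cong-≗; sum-replicate-zero; ∑-distrib-+)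
open import Data.Empty using (⊥-elim)
open import Data.Fin using (Fin; zero; suc; punchIn; punchOut)
open import Data.Fin.Properties
  using (¬Fin0; 0≢1+n; suc-injective; punchInᵢ≢i; punchIn-punchOut; punchOut-punchIn;
         punchOut-cong; punchOut-injective; injective⇒≤)
import Data.Integer as ℤ
import Data.Integer.Properties as ℤ
open import Data.List.Membership.Propositional.Properties using (∈-lookup; ∈-allFin)
open import Data.List.Membership.Propositional.Properties.WithK using (unique⇒irrelevant)
open import Data.List.Relation.Unary.Any using (here; there; index)
open import Data.List.Relation.Unary.Any.Properties using (lookup-index)
open import Data.Unit using (tt)
open import Data.Vec using (Vec; []; _∷_)
import Data.Vec as Vec
open import Data.Vec.Functional using (removeAt)
open import Data.Vec.Properties using (lookup∘tabulate; tabulate∘lookup; tabulate-cong)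
open import Function.Base using (_∘_)
open import Function.Construct.Composition using (_↣-∘_)
open import Function.Definitions using (Injective)
open import Function.Properties.Inverse using (↔-sym; ↔⇒↣)
open import Relation.Nullary using (¬_; Dec; yes; no)
open import Relation.Nullary.Decidable
  using (decidable-stable; ¬¬-excluded-middle; map′; _×-dec_; recompute)
open import Relation.Unary using (Decidable)

open ≡-Reasoning

¬¬-∀∈ : ∀ {A : Set} {P : A → Set} (xs : List A) →
        (∀ x → ¬ ¬ P x) → ¬ ¬ (∀ {x} → x ∈ xs → P x)
¬¬-∀∈ []       _   k = k λ ()
¬¬-∀∈ (x ∷ xs) ¬¬P k = ¬¬P x λ px → ¬¬-∀∈ xs ¬¬P λ P-on-xs → k λ where
  (here refl)  → px
  (there x∈xs) → P-on-xs x∈xs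

¬¬-∀-finite : ∀ {A : Set} {P : A → Set} {n} → A ↔ Fin n →
              (∀ a → ¬ ¬ P a) → ¬ ¬ (∀ a → P a)
¬¬-∀-finite {P = P} A↔n ¬¬P k =
  ¬¬-∀∈ (allFin _) (¬¬P ∘ Inverse.from A↔n) λ P-on-all →
  k λ a → subst P (Inverse.strictlyInverseʳ A↔n a) (P-on-all (∈-allFin (Inverse.to A↔n a)))

↣⇒≤ : ∀ {A B : Set} {n m} → A ↔ Fin n → B ↔ Fin m → A ↣ B → n ≤ m
↣⇒≤ A↔n B↔m A↣B =
  injective⇒≤ (Injection.injective (↔⇒↣ B↔m ↣-∘ (A↣B ↣-∘ ↔⇒↣ (↔-sym A↔n))))

𝟙 : ∀ {P : Set} → Dec P → ℕ
𝟙 (yes _) = 1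
𝟙 (no _)  = 0

count≡sum-𝟙 : ∀ {A : Set} {P : A → Set} (P? : Decidable P) {n} (xs : Vec A n) →
              Vec.count P? xs ≡ sum (λ i → 𝟙 (P? (Vec.lookup xs i)))
count≡sum-𝟙 P? []       = refl
count≡sum-𝟙 P? (x ∷ xs) with P? x
... | yes _ = cong suc (count≡sum-𝟙 P? xs)
... | no _  = count≡sum-𝟙 P? xs

sum-reindex : ∀ {a b} (ι : Fin a → Fin b) → Injective _≡_ _≡_ ι → (f : Fin b → ℕ) →
              (∀ k → (∀ i → ι i ≢ k) → f k ≡ 0) → sum (f ∘ ι) ≡ sum f
sum-reindex {zero} {b} ι _ f outside =
  sym (trans (sum-cong-≗ (λ k → outside k λ ())) (sum-replicate-zero b))
sum-reindex {suc a} {zero} ι _ _ _ = ⊥-elim (¬Fin0 (ι zero))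
sum-reindex {suc a} {suc b} ι ι-injective f outside = begin
  f k₀ + sum (f ∘ ι ∘ suc)
    ≡⟨ cong (f k₀ +_) (sum-cong-≗ (cong f ∘ sym ∘ punchIn-punchOut ∘ k₀≢)) ⟩
  f k₀ + sum (removeAt f k₀ ∘ ι′)
    ≡⟨ cong (f k₀ +_) (sum-reindex ι′ ι′-injective (removeAt f k₀) outside′) ⟩
  f k₀ + sum (removeAt f k₀)
    ≡⟨ sum-remove f ⟨
  sum f ∎
  where
  k₀ : Fin (suc b)
  k₀ = ι zero
  k₀≢ : ∀ i → k₀ ≢ ι (suc i)
  k₀≢ i = 0≢1+n ∘ ι-injective
  ι′ : Fin a → Fin b
  ι′ i = punchOut (k₀≢ i)
  ι′-injective : Injective _≡_ _≡_ ι′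
  ι′-injective e = suc-injective (ι-injective (punchOut-injective (k₀≢ _) (k₀≢ _) e))
  outside′ : ∀ k → (∀ i → ι′ i ≢ k) → removeAt f k₀ k ≡ 0
  outside′ k missed = outside (punchIn k₀ k) λ where
    zero    e → punchInᵢ≢i k₀ k (sym e)
    (suc i) e → missed i (trans (punchOut-cong k₀ e) (punchOut-punchIn k₀))

onlyIf : ∀ {P : Set} → Dec P → (P → ℕ) → ℕ
onlyIf (yes p) g = g p
onlyIf (no _)  _ = 0

onlyIf-∉ : ∀ {P : Set} {g : P → ℕ} → ¬ P → (P? : Dec P) → onlyIf P? g ≡ 0
onlyIf-∉ ¬p (yes p) = ⊥-elim (¬p p)
onlyIf-∉ ¬p (no _)  = refl

module _ {A : Set} where

  DecidableOn : List A → (A → Set) → Set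
  DecidableOn xs P = ∀ {x} → x ∈ xs → Dec (P x)

  ¬¬-decidableOn : (xs : List A) (P : A → Set) → ¬ ¬ DecidableOn xs P
  ¬¬-decidableOn xs P = ¬¬-∀∈ xs (λ _ → ¬¬-excluded-middle)

  index-∈-lookup : (xs : List A) (i : Fin (length xs)) → index (∈-lookup {xs = xs} i) ≡ i
  index-∈-lookup (x ∷ xs) zero    = refl
  index-∈-lookup (x ∷ xs) (suc i) = cong suc (index-∈-lookup xs i)

  ∈-fun-resp : ∀ {B : Set} {xs : List A} {x y} → Unique xs → (g : ∀ {z} → z ∈ xs → B) →
               x ≡ y → (x∈ : x ∈ xs) (y∈ : y ∈ xs) → g x∈ ≡ g y∈
  ∈-fun-resp u g refl x∈ y∈ = cong g (unique⇒irrelevant u x∈ y∈)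

  unique-lookup-injective : ∀ {xs : List A} → Unique xs → Injective _≡_ _≡_ (lookup xs)
  unique-lookup-injective {xs} u {i} {j} e = begin
    i                    ≡⟨ index-∈-lookup xs i ⟨
    index (∈-lookup i)   ≡⟨ ∈-fun-resp u index e (∈-lookup i) (∈-lookup j) ⟩
    index (∈-lookup j)   ≡⟨ index-∈-lookup xs j ⟩
    j                    ∎

  lookup-∈-ext : ∀ {B : Set} {xs : List A} (v w : Vec B (length xs)) →
                 (∀ {x} (x∈ : x ∈ xs) → Vec.lookup v (index x∈) ≡ Vec.lookup w (index x∈)) → v ≡ w
  lookup-∈-ext {xs = xs} v w same = begin
    v                            ≡⟨ tabulate∘lookup v ⟨
    Vec.tabulate (Vec.lookup v)  ≡⟨ tabulate-cong lookups ⟩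
    Vec.tabulate (Vec.lookup w)  ≡⟨ tabulate∘lookup w ⟩
    w                            ∎
    where
    lookups : ∀ i → Vec.lookup v i ≡ Vec.lookup w i
    lookups i =
      subst (λ j → Vec.lookup v j ≡ Vec.lookup w j) (index-∈-lookup xs i) (same (∈-lookup i))

  ∑∈ : (xs : List A) → (∀ {x} → x ∈ xs → ℕ) → ℕ
  ∑∈ xs g = sum (λ i → g (∈-lookup {xs = xs} i))

  onlyIf-∈ : ∀ {xs : List A} {x y} → Unique xs → (g : ∀ {z} → z ∈ xs → ℕ) →
             x ≡ y → (x∈ : x ∈ xs) (y∈? : Dec (y ∈ xs)) → onlyIf y∈? g ≡ g x∈
  onlyIf-∈ u g x≡y x∈ (yes y∈) = ∈-fun-resp u g (sym x≡y) y∈ x∈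
  onlyIf-∈ u g refl x∈ (no x∉) = ⊥-elim (x∉ x∈)

  ∑∈-⊆ : ∀ {xs ys : List A} → Unique xs → Unique ys → (xs⊆ys : ∀ {x} → x ∈ xs → x ∈ ys) →
         (xs? : DecidableOn ys (_∈ xs)) (g : ∀ {x} → x ∈ xs → ℕ) →
         ∑∈ xs g ≡ ∑∈ ys (λ y∈ → onlyIf (xs? y∈) g)
  ∑∈-⊆ {xs} {ys} uxs uys xs⊆ys xs? g =
    trans (sum-cong-≗ at-image) (sum-reindex ι ι-injective extended outside)
    where
    ι : Fin (length xs) → Fin (length ys)
    ι i = index (xs⊆ys (∈-lookup i))
    extended : Fin (length ys) → ℕ
    extended k = onlyIf (xs? (∈-lookup k)) g
    at-image : ∀ i → g (∈-lookup i) ≡ extended (ι i)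
    at-image i =
      sym (onlyIf-∈ uxs g (lookup-index (xs⊆ys (∈-lookup i))) (∈-lookup i) (xs? (∈-lookup (ι i))))
    ι-injective : Injective _≡_ _≡_ ι
    ι-injective {i} {j} e = unique-lookup-injective uxs (begin
      lookup xs i       ≡⟨ lookup-index (xs⊆ys (∈-lookup i)) ⟩
      lookup ys (ι i)   ≡⟨ cong (lookup ys) e ⟩
      lookup ys (ι j)   ≡⟨ lookup-index (xs⊆ys (∈-lookup j)) ⟨
      lookup xs j       ∎)
    outside : ∀ k → (∀ i → ι i ≢ k) → extended k ≡ 0
    outside k missed with xs? (∈-lookup k)
    ... | no _  = refl
    ... | yes a = ⊥-elim (missed (index a) (trans
          (∈-fun-resp uys index (sym (lookup-index a)) (xs⊆ys (∈-lookup (index a))) (∈-lookup k))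
          (index-∈-lookup ys k)))

_≤ℙ∞?_ : ∀ n z → Dec (n ≤ℙ∞ z)
n ≤ℙ∞? fin z = ℤ.+ n ℤ.≤? z
n ≤ℙ∞? ∞     = yes tt

≤-≤ℙ∞-trans : ∀ {a b z} → a ≤ b → b ≤ℙ∞ z → a ≤ℙ∞ z
≤-≤ℙ∞-trans {z = fin z} a≤b b≤z = ℤ.≤-trans (ℤ.+≤+ a≤b) b≤z
≤-≤ℙ∞-trans {z = ∞}     _   _   = tt

≤ℙ∞-≤∞-trans : ∀ {n z w} → n ≤ℙ∞ z → z ≤∞ w → n ≤ℙ∞ w
≤ℙ∞-≤∞-trans n≤z (fin≤fin z≤w) = ℤ.≤-trans n≤z z≤w
≤ℙ∞-≤∞-trans _   (_ ≤∞∞)        = tt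

module Fillings {X : Set} (_≼_ : X → X → Set) (O : Labelling _≼_) where

  _⋖_ : X → X → Set
  _⋖_ = Defs._⋖_ _≼_

  _≤[_]_ : ∀ {x y} → ℕ → x ⋖ y → ℕ → Set
  a ≤[ c ] b = a ≤ℙ∞ fun (O _ _ c) b

  _≤[_]?_ : ∀ {x y} a (c : x ⋖ y) b → Dec (a ≤[ c ] b)
  a ≤[ c ]? b = a ≤ℙ∞? fun (O _ _ c) b

  ≤-≤[]-trans : ∀ {x y} {c : x ⋖ y} {a b n} → a ≤ b → b ≤[ c ] n → a ≤[ c ] n
  ≤-≤[]-trans = ≤-≤ℙ∞-trans

  ≤[]-monoʳ : ∀ {x y} {c : x ⋖ y} {n a b} → 1 ≤ a → a ≤ b → n ≤[ c ] a → n ≤[ c ] b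
  ≤[]-monoʳ {x} {y} {c} {a = a} {b} 1≤a a≤b n≤a =
    ≤ℙ∞-≤∞-trans n≤a (mono (O x y c) a b 1≤a a≤b)

  ≤[]-stable : ∀ {x y} {c : x ⋖ y} {a b} → ¬ ¬ (a ≤[ c ] b) → a ≤[ c ] b
  ≤[]-stable = decidable-stable (_ ≤[ _ ]? _)

  -- A map Q → ℕ that takes membership proofs as arguments.  In a duplicate-free list these
  -- proofs are unique, so a filling cannot depend on which one it receives (∈-fun-resp).
  Filling : List X → Set
  Filling Q = ∀ {x} → x ∈ Q → ℕ

  _≐_ : ∀ {Q} → Filling Q → Filling Q → Set
  _≐_ {Q} g h = ∀ {x} (x∈ : x ∈ Q) → g x∈ ≡ h x∈

  Positive : ∀ {Q} → Filling Q → Set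
  Positive {Q} g = ∀ {x} (x∈ : x ∈ Q) → 1 ≤ g x∈

  Compatible : ∀ {Q} → Filling Q → Set
  Compatible {Q} g = ∀ {x y} (x∈ : x ∈ Q) (y∈ : y ∈ Q) (c : x ⋖ y) → g x∈ ≤[ c ] g y∈

  value : ∀ {Q} → Tableau _≼_ O Q → Filling Q
  value T x∈ = Vec.lookup (Tableau.val T) (index x∈)

  value-positive : ∀ {Q} (T : Tableau _≼_ O Q) → Positive (value T)
  value-positive (tab v ok) x∈ = recompute (1 ≤? _) (proj₁ ok (index x∈))

  value-compatible : ∀ {Q} (T : Tableau _≼_ O Q) → Compatible (value T)
  value-compatible (tab v ok) {x} {y} x∈ y∈ c =
    recompute (_ ≤[ c ]? _)
              (along (lookup-index x∈) (lookup-index y∈) (proj₂ ok (index x∈) (index y∈)))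
    where
    along : ∀ {x′ y′} → x ≡ x′ → y ≡ y′ →
            ((c′ : x′ ⋖ y′) → Vec.lookup v (index x∈) ≤[ c′ ] Vec.lookup v (index y∈)) →
            Vec.lookup v (index x∈) ≤[ c ] Vec.lookup v (index y∈)
    along refl refl at = at c

  tabulate∈ : ∀ {Q} → Filling Q → Vec ℕ (length Q)
  tabulate∈ g = Vec.tabulate (λ i → g (∈-lookup i))

  tableau : ∀ {Q} (g : Filling Q) → Positive g → Compatible g → Tableau _≼_ O Q
  tableau {Q} g g⁺ g✓ = tab (tabulate∈ g) (positive , compatible)
    where
    positive : ∀ i → 1 ≤ Vec.lookup (tabulate∈ g) i
    positive i rewrite lookup∘tabulate (λ i → g (∈-lookup i)) i = g⁺ (∈-lookup i)
    compatible : ∀ i j (c : lookup Q i ⋖ lookup Q j) →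
                 Vec.lookup (tabulate∈ g) i ≤[ c ] Vec.lookup (tabulate∈ g) j
    compatible i j c rewrite lookup∘tabulate (λ i → g (∈-lookup i)) i
                           | lookup∘tabulate (λ i → g (∈-lookup i)) j = g✓ (∈-lookup i) (∈-lookup j) c

  value-tableau : ∀ {Q} {g : Filling Q} {g⁺ : Positive g} {g✓ : Compatible g} →
                  Unique Q → value (tableau g g⁺ g✓) ≐ g
  value-tableau {g = g} u x∈ =
    trans (lookup∘tabulate (λ i → g (∈-lookup i)) (index x∈))
          (∈-fun-resp u g (sym (lookup-index x∈)) (∈-lookup (index x∈)) x∈)

  mult≡∑∈ : ∀ {Q} (T : Tableau _≼_ O Q) v → mult _≼_ O T v ≡ ∑∈ Q (λ x∈ → 𝟙 (value T x∈ ≟ v))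
  mult≡∑∈ {Q} (tab w _) v =
    trans (count≡sum-𝟙 (_≟ v) w)
          (sum-cong-≗ λ i → cong (λ j → 𝟙 (Vec.lookup w j ≟ v)) (sym (index-∈-lookup Q i)))

  mult-tableau≡∑∈ : ∀ {Q} (g : Filling Q) (g⁺ : Positive g) (g✓ : Compatible g) v →
                    mult _≼_ O (tableau g g⁺ g✓) v ≡ ∑∈ Q (λ x∈ → 𝟙 (g x∈ ≟ v))
  mult-tableau≡∑∈ g _ _ v =
    trans (count≡sum-𝟙 (_≟ v) (tabulate∈ g))
          (sum-cong-≗ λ i → cong (λ n → 𝟙 (n ≟ v)) (lookup∘tabulate (λ i → g (∈-lookup i)) i))

  tableau-injective : ∀ {Q} {g h : Filling Q} {g⁺ : Positive g} {g✓ : Compatible g}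
                      {h⁺ : Positive h} {h✓ : Compatible h} → Unique Q →
                      tableau g g⁺ g✓ ≡ tableau h h⁺ h✓ → g ≐ h
  tableau-injective {g = g} {h} {g⁺} {g✓} {h⁺} {h✓} u eq x∈ = begin
    g x∈                             ≡⟨ value-tableau {g⁺ = g⁺} {g✓} u x∈ ⟨
    value (tableau g g⁺ g✓) x∈       ≡⟨ cong (λ T → value T x∈) eq ⟩
    value (tableau h h⁺ h✓) x∈       ≡⟨ value-tableau {g⁺ = h⁺} {h✓} u x∈ ⟩
    h x∈                             ∎

  value-injective : ∀ {Q} (T T′ : Tableau _≼_ O Q) → value T ≐ value T′ → T ≡ T′
  value-injective (tab v _) (tab v′ _) same with refl ← lookup-∈-ext v v′ same = refl

module Swap {X : Set} (_≼_ : X → X → Set) (O : Labelling _≼_)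
  (I J M U : List X) (uI : Unique I) (uJ : Unique J) (uM : Unique M) (uU : Unique U)
  (I-ideal : IsOrderIdeal _≼_ I) (J-ideal : IsOrderIdeal _≼_ J)
  (M⇔I∩J : ∀ x → (x ∈ M) ⇔ (x ∈ I × x ∈ J))
  (U⇔I∪J : ∀ x → (x ∈ U) ⇔ (x ∈ I ⊎ x ∈ J)) where

  open Fillings _≼_ O

  M⊆I : ∀ {x} → x ∈ M → x ∈ I
  M⊆I m = proj₁ (Equivalence.to (M⇔I∩J _) m)

  M⊆J : ∀ {x} → x ∈ M → x ∈ J
  M⊆J m = proj₂ (Equivalence.to (M⇔I∩J _) m)

  I⊆U : ∀ {x} → x ∈ I → x ∈ U
  I⊆U a = Equivalence.from (U⇔I∪J _) (inj₁ a)

  J⊆U : ∀ {x} → x ∈ J → x ∈ U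
  J⊆U b = Equivalence.from (U⇔I∪J _) (inj₂ b)

  M⊆U : ∀ {x} → x ∈ M → x ∈ U
  M⊆U = I⊆U ∘ M⊆I

  I-down : ∀ {x y} → x ⋖ y → y ∈ I → x ∈ I
  I-down c a = I-ideal _ _ a (proj₁ (proj₁ c))

  J-down : ∀ {x y} → x ⋖ y → y ∈ J → x ∈ J
  J-down c b = J-ideal _ _ b (proj₁ (proj₁ c))

  valuesAt : Filling I → Filling M → ∀ {x} → x ∈ M → ℕ × ℕ
  valuesAt ρ κ m = ρ (M⊆I m) , κ m

  -- Exchanging the values at exactly one endpoint of c breaks a tableau condition on c.
  Clash : ∀ {x y} → x ⋖ y → ℕ × ℕ → ℕ × ℕ → Set
  Clash c (ρx , κx) (ρy , κy) = ¬ (ρx ≤[ c ] κy) ⊎ ¬ (κx ≤[ c ] ρy)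

  -- ρ holds the values of the tableau that also covers I ∖ J, κ those of the other one on I ∩ J.
  -- A point of I ∩ J must be swapped if its κ-value fails the condition towards a cover in I ∖ J,
  -- where the ρ-value stays put, and swapping spreads along clashing covers.
  data MustSwap (ρ : Filling I) (κ : Filling M) : X → Set where
    boundary : ∀ {x t} (m : x ∈ M) (a : t ∈ I) → t ∉ J → (c : x ⋖ t) →
               ¬ (κ m ≤[ c ] ρ a) → MustSwap ρ κ x
    up       : ∀ {x y} (m : x ∈ M) (m′ : y ∈ M) (c : x ⋖ y) →
               Clash c (valuesAt ρ κ m) (valuesAt ρ κ m′) → MustSwap ρ κ x → MustSwap ρ κ y
    down     : ∀ {x y} (m : x ∈ M) (m′ : y ∈ M) (c : x ⋖ y) →
               Clash c (valuesAt ρ κ m) (valuesAt ρ κ m′) → MustSwap ρ κ y → MustSwap ρ κ x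

  MustSwap-transfer : ∀ {ρ ρ′ : Filling I} {κ κ′ : Filling M} →
    (∀ {x} (m : x ∈ M) → MustSwap ρ κ x → valuesAt ρ′ κ′ m ≡ valuesAt ρ κ m) →
    (∀ {t} (a : t ∈ I) → t ∉ J → ρ′ a ≡ ρ a) →
    ∀ {x} → MustSwap ρ κ x → MustSwap ρ′ κ′ x
  MustSwap-transfer agree agree-I∖J r@(boundary m a t∉J c κ≰ρ) =
    boundary m a t∉J c (κ≰ρ ∘ subst₂ _≤[ c ]_ (cong proj₂ (agree m r)) (agree-I∖J a t∉J))
  MustSwap-transfer agree agree-I∖J r@(up m m′ c clash r₀) =
    up m m′ c (subst₂ (Clash c) (sym (agree m r₀)) (sym (agree m′ r)) clash)
       (MustSwap-transfer agree agree-I∖J r₀)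
  MustSwap-transfer agree agree-I∖J r@(down m m′ c clash r₀) =
    down m m′ c (subst₂ (Clash c) (sym (agree m r)) (sym (agree m′ r₀)) clash)
         (MustSwap-transfer agree agree-I∖J r₀)

  SwapRegion : Tableau _≼_ O I → Tableau _≼_ O J → X → Set
  SwapRegion σT τT = MustSwap (value σT) (λ m → value τT (M⊆J m))

  SwapRegionOf : ∀ {α} → ProductTerm _≼_ O I J α → X → Set
  SwapRegionOf p = SwapRegion (ProductTerm.left p) (ProductTerm.right p)

  SwapRegionOfImage : Filling M → Filling U → X → Set
  SwapRegionOfImage σ′ τ′ = MustSwap (λ a → τ′ (I⊆U a)) σ′

  SwapRegionOfImage-cong : ∀ {σ′₁ σ′₂ : Filling M} {τ′₁ τ′₂ : Filling U} → σ′₁ ≐ σ′₂ → τ′₁ ≐ τ′₂ →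
                           ∀ {x} → SwapRegionOfImage σ′₁ τ′₁ x → SwapRegionOfImage σ′₂ τ′₂ x
  SwapRegionOfImage-cong σ′≐ τ′≐ =
    MustSwap-transfer (λ m _ → sym (cong₂ _,_ (τ′≐ (M⊆U m)) (σ′≐ m))) (λ a _ → sym (τ′≐ (I⊆U a)))

  data Region (R : X → Set) (x : X) : Set where
    swapped : x ∈ M → R x → Region R x
    kept    : x ∈ M → ¬ R x → Region R x
    onlyI   : x ∈ I → x ∉ J → Region R x
    onlyJ   : x ∈ J → x ∉ I → Region R x

  module _ (I? : DecidableOn U (_∈ I)) (J? : DecidableOn U (_∈ J)) where

    M? : DecidableOn U (_∈ M)
    M? u = map′ (Equivalence.from (M⇔I∩J _)) (Equivalence.to (M⇔I∩J _)) (I? u ×-dec J? u)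

    module Exchange (σT : Tableau _≼_ O I) (τT : Tableau _≼_ O J)
                    (R? : DecidableOn M (SwapRegion σT τT)) where

      σ : Filling I
      σ = value σT

      τ : Filling J
      τ = value τT

      σ-compatible : Compatible σ
      σ-compatible = value-compatible σT

      τ-compatible : Compatible τ
      τ-compatible = value-compatible τT

      τM : Filling M
      τM m = τ (M⊆J m)

      R : X → Set
      R = SwapRegion σT τT

      σ<τ-resp : ∀ {x} (m m₀ : x ∈ M) → σ (M⊆I m) < τ (M⊆J m) → σ (M⊆I m₀) < τ (M⊆J m₀)
      σ<τ-resp m m₀ = subst (λ m → σ (M⊆I m) < τ (M⊆J m)) (unique⇒irrelevant uM m m₀)

      σ<τ : ∀ {x} → R x → (m : x ∈ M) → σ (M⊆I m) < τ (M⊆J m)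
      σ<τ (boundary m a _ c τ≰σ) m₀ =
        σ<τ-resp m m₀ (≰⇒> λ τ≤σ → τ≰σ (≤-≤[]-trans τ≤σ (σ-compatible (M⊆I m) a c)))
      σ<τ (up m m′ c clash r) m₀ = σ<τ-resp m′ m₀ ([ ⊥-elim ∘ ¬σ≰τ , ≰⇒> ∘ lt ]′ clash)
        where
        τ-c : τ (M⊆J m) ≤[ c ] τ (M⊆J m′)
        τ-c = τ-compatible (M⊆J m) (M⊆J m′) c
        ¬σ≰τ : ¬ ¬ (σ (M⊆I m) ≤[ c ] τ (M⊆J m′))
        ¬σ≰τ σ≰τ = σ≰τ (≤-≤[]-trans (<⇒≤ (σ<τ r m)) τ-c)
        lt : ¬ (τ (M⊆J m) ≤[ c ] σ (M⊆I m′)) → ¬ (τ (M⊆J m′) ≤ σ (M⊆I m′))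
        lt τ≰σ τ≤σ = τ≰σ (≤[]-monoʳ (value-positive τT (M⊆J m′)) τ≤σ τ-c)
      σ<τ (down m m′ c clash r) m₀ = σ<τ-resp m m₀ ([ ⊥-elim ∘ ¬σ≰τ , ≰⇒> ∘ lt ]′ clash)
        where
        σ-c : σ (M⊆I m) ≤[ c ] σ (M⊆I m′)
        σ-c = σ-compatible (M⊆I m) (M⊆I m′) c
        ¬σ≰τ : ¬ ¬ (σ (M⊆I m) ≤[ c ] τ (M⊆J m′))
        ¬σ≰τ σ≰τ = σ≰τ (≤[]-monoʳ (value-positive σT (M⊆I m′)) (<⇒≤ (σ<τ r m′)) σ-c)
        lt : ¬ (τ (M⊆J m) ≤[ c ] σ (M⊆I m′)) → ¬ (τ (M⊆J m) ≤ σ (M⊆I m))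
        lt τ≰σ τ≤σ = τ≰σ (≤-≤[]-trans τ≤σ σ-c)

      region : ∀ {x} → x ∈ U → Region R x
      region u with I? u | J? u
      ... | yes a  | yes b  = inM (Equivalence.from (M⇔I∩J _) (a , b))
        where
        inM : ∀ {x} → x ∈ M → Region R x
        inM m with R? m
        ... | yes r = swapped m r
        ... | no ¬r = kept m ¬r
      ... | yes a  | no x∉J = onlyI a x∉J
      ... | no x∉I | yes b  = onlyJ b x∉I
      ... | no x∉I | no x∉J = ⊥-elim ([ x∉I , x∉J ]′ (Equivalence.to (U⇔I∪J _) u))

      regionValue : ∀ {x} → Region R x → ℕ
      regionValue (swapped m _) = σ (M⊆I m)
      regionValue (kept m _)    = τ (M⊆J m)
      regionValue (onlyI a _)   = σ a
      regionValue (onlyJ b _)   = τ b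

      σ′ : Filling M
      σ′ m with R? m
      ... | yes _ = τ (M⊆J m)
      ... | no _  = σ (M⊆I m)

      τ′ : Filling U
      τ′ u = regionValue (region u)

      σ′-τ : ∀ {x} (m : x ∈ M) (b : x ∈ J) → R x → σ′ m ≡ τ b
      σ′-τ m b r with R? m
      ... | yes _ = ∈-fun-resp uJ τ refl (M⊆J m) b
      ... | no ¬r = ⊥-elim (¬r r)

      σ′-σ : ∀ {x} (m : x ∈ M) (a : x ∈ I) → ¬ R x → σ′ m ≡ σ a
      σ′-σ m a ¬r with R? m
      ... | yes r = ⊥-elim (¬r r)
      ... | no _  = ∈-fun-resp uI σ refl (M⊆I m) a

      τ′-σ : ∀ {x} (u : x ∈ U) (a : x ∈ I) → x ∉ J ⊎ R x → τ′ u ≡ σ a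
      τ′-σ {x} u a = at (region u)
        where
        at : (g : Region R x) → x ∉ J ⊎ R x → regionValue g ≡ σ a
        at (swapped m _)  _          = ∈-fun-resp uI σ refl (M⊆I m) a
        at (kept m _)     (inj₁ x∉J) = ⊥-elim (x∉J (M⊆J m))
        at (kept _ ¬r)    (inj₂ r)   = ⊥-elim (¬r r)
        at (onlyI a′ _)   _          = ∈-fun-resp uI σ refl a′ a
        at (onlyJ _ x∉I)  _          = ⊥-elim (x∉I a)

      τ′-τ : ∀ {x} (u : x ∈ U) (b : x ∈ J) → x ∉ I ⊎ ¬ R x → τ′ u ≡ τ b
      τ′-τ {x} u b = at (region u)
        where
        at : (g : Region R x) → x ∉ I ⊎ ¬ R x → regionValue g ≡ τ b
        at (swapped m _)  (inj₁ x∉I) = ⊥-elim (x∉I (M⊆I m))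
        at (swapped _ r)  (inj₂ ¬r)  = ⊥-elim (¬r r)
        at (kept m _)     _          = ∈-fun-resp uJ τ refl (M⊆J m) b
        at (onlyI _ x∉J)  _          = ⊥-elim (x∉J b)
        at (onlyJ b′ _)   _          = ∈-fun-resp uJ τ refl b′ b

      σ′-positive : Positive σ′
      σ′-positive m with R? m
      ... | yes _ = value-positive τT (M⊆J m)
      ... | no _  = value-positive σT (M⊆I m)

      σ′-compatible : Compatible σ′
      σ′-compatible m m′ c with R? m | R? m′
      ... | yes _ | yes _  = τ-compatible (M⊆J m) (M⊆J m′) c
      ... | no _  | no _   = σ-compatible (M⊆I m) (M⊆I m′) c
      ... | yes r | no ¬r′ = ≤[]-stable λ τ≰σ → ¬r′ (up m m′ c (inj₂ τ≰σ) r)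
      ... | no ¬r | yes r′ = ≤[]-stable λ σ≰τ → ¬r (down m m′ c (inj₁ σ≰τ) r′)

      regionValue-positive : ∀ {x} (g : Region R x) → 1 ≤ regionValue g
      regionValue-positive (swapped m _) = value-positive σT (M⊆I m)
      regionValue-positive (kept m _)    = value-positive τT (M⊆J m)
      regionValue-positive (onlyI a _)   = value-positive σT a
      regionValue-positive (onlyJ b _)   = value-positive τT b

      regionValue-compatible : ∀ {x y} (g : Region R x) (g′ : Region R y) (c : x ⋖ y) →
                               regionValue g ≤[ c ] regionValue g′
      regionValue-compatible (swapped m r) (swapped m′ _) c = σ-compatible (M⊆I m) (M⊆I m′) c
      regionValue-compatible (swapped m r) (kept m′ ¬r′) c =
        ≤[]-stable λ σ≰τ → ¬r′ (up m m′ c (inj₁ σ≰τ) r)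
      regionValue-compatible (swapped m r) (onlyI a′ _) c = σ-compatible (M⊆I m) a′ c
      regionValue-compatible (swapped m r) (onlyJ b′ _) c =
        ≤-≤[]-trans (<⇒≤ (σ<τ r m)) (τ-compatible (M⊆J m) b′ c)
      regionValue-compatible (kept m ¬r) (swapped m′ r′) c =
        ≤[]-stable λ τ≰σ → ¬r (down m m′ c (inj₂ τ≰σ) r′)
      regionValue-compatible (kept m _) (kept m′ _) c = τ-compatible (M⊆J m) (M⊆J m′) c
      regionValue-compatible (kept m ¬r) (onlyI a′ y∉J) c =
        ≤[]-stable λ τ≰σ → ¬r (boundary m a′ y∉J c τ≰σ)
      regionValue-compatible (kept m _) (onlyJ b′ _) c = τ-compatible (M⊆J m) b′ c
      regionValue-compatible (onlyI _ x∉J) (swapped m′ _) c = ⊥-elim (x∉J (J-down c (M⊆J m′)))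
      regionValue-compatible (onlyI _ x∉J) (kept m′ _) c = ⊥-elim (x∉J (J-down c (M⊆J m′)))
      regionValue-compatible (onlyI a _) (onlyI a′ _) c = σ-compatible a a′ c
      regionValue-compatible (onlyI _ x∉J) (onlyJ b′ _) c = ⊥-elim (x∉J (J-down c b′))
      regionValue-compatible (onlyJ _ x∉I) (swapped m′ _) c = ⊥-elim (x∉I (I-down c (M⊆I m′)))
      regionValue-compatible (onlyJ _ x∉I) (kept m′ _) c = ⊥-elim (x∉I (I-down c (M⊆I m′)))
      regionValue-compatible (onlyJ _ x∉I) (onlyI a′ _) c = ⊥-elim (x∉I (I-down c a′))
      regionValue-compatible (onlyJ b _) (onlyJ b′ _) c = τ-compatible b b′ c

      σ′T : Tableau _≼_ O M
      σ′T = tableau σ′ σ′-positive σ′-compatible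

      τ′-positive : Positive τ′
      τ′-positive u = regionValue-positive (region u)

      τ′-compatible : Compatible τ′
      τ′-compatible u u′ = regionValue-compatible (region u) (region u′)

      τ′T : Tableau _≼_ O U
      τ′T = tableau τ′ τ′-positive τ′-compatible

      module _ (v : ℕ) where

        hit : ℕ → ℕ
        hit n = 𝟙 (n ≟ v)

        σ-hit : Filling I
        σ-hit a = hit (σ a)

        τ-hit : Filling J
        τ-hit b = hit (τ b)

        σ′-hit : Filling M
        σ′-hit m = hit (σ′ m)

        τ′-hit : Filling U
        τ′-hit u = hit (τ′ u)

        on-M : ∀ {x} (u : x ∈ U) (m : x ∈ M) → onlyIf (M? u) σ′-hit ≡ σ′-hit m
        on-M u m = onlyIf-∈ uM σ′-hit refl m (M? u)

        on-I : ∀ {x} (u : x ∈ U) (a : x ∈ I) → onlyIf (I? u) σ-hit ≡ σ-hit a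
        on-I u a = onlyIf-∈ uI σ-hit refl a (I? u)

        on-J : ∀ {x} (u : x ∈ U) (b : x ∈ J) → onlyIf (J? u) τ-hit ≡ τ-hit b
        on-J u b = onlyIf-∈ uJ τ-hit refl b (J? u)

        content-at : ∀ {x} (u : x ∈ U) (g : Region R x) →
          onlyIf (M? u) σ′-hit + hit (regionValue g) ≡
          onlyIf (I? u) σ-hit + onlyIf (J? u) τ-hit
        content-at u (swapped m r) = begin
          onlyIf (M? u) σ′-hit + σ-hit (M⊆I m)  ≡⟨ cong (_+ σ-hit (M⊆I m)) (on-M u m) ⟩
          σ′-hit m + σ-hit (M⊆I m)              ≡⟨ cong (λ n → hit n + σ-hit (M⊆I m)) (σ′-τ m (M⊆J m) r) ⟩
          τ-hit (M⊆J m) + σ-hit (M⊆I m)         ≡⟨ +-comm (τ-hit (M⊆J m)) (σ-hit (M⊆I m)) ⟩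
          σ-hit (M⊆I m) + τ-hit (M⊆J m)         ≡⟨ cong₂ _+_ (on-I u (M⊆I m)) (on-J u (M⊆J m)) ⟨
          onlyIf (I? u) σ-hit + onlyIf (J? u) τ-hit ∎
        content-at u (kept m ¬r) = begin
          onlyIf (M? u) σ′-hit + τ-hit (M⊆J m)  ≡⟨ cong (_+ τ-hit (M⊆J m)) (on-M u m) ⟩
          σ′-hit m + τ-hit (M⊆J m)              ≡⟨ cong (λ n → hit n + τ-hit (M⊆J m)) (σ′-σ m (M⊆I m) ¬r) ⟩
          σ-hit (M⊆I m) + τ-hit (M⊆J m)         ≡⟨ cong₂ _+_ (on-I u (M⊆I m)) (on-J u (M⊆J m)) ⟨
          onlyIf (I? u) σ-hit + onlyIf (J? u) τ-hit ∎
        content-at u (onlyI a x∉J) = begin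
          onlyIf (M? u) σ′-hit + σ-hit a        ≡⟨ cong (_+ σ-hit a) (onlyIf-∉ (x∉J ∘ M⊆J) (M? u)) ⟩
          σ-hit a                               ≡⟨ +-identityʳ (σ-hit a) ⟨
          σ-hit a + 0                           ≡⟨ cong₂ _+_ (on-I u a) (onlyIf-∉ x∉J (J? u)) ⟨
          onlyIf (I? u) σ-hit + onlyIf (J? u) τ-hit ∎
        content-at u (onlyJ b x∉I) = begin
          onlyIf (M? u) σ′-hit + τ-hit b        ≡⟨ cong (_+ τ-hit b) (onlyIf-∉ (x∉I ∘ M⊆I) (M? u)) ⟩
          0 + τ-hit b                           ≡⟨ cong₂ _+_ (onlyIf-∉ x∉I (I? u)) (on-J u b) ⟨
          onlyIf (I? u) σ-hit + onlyIf (J? u) τ-hit ∎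

        exchange-preserves-content :
          mult _≼_ O σ′T v + mult _≼_ O τ′T v ≡ mult _≼_ O σT v + mult _≼_ O τT v
        exchange-preserves-content = begin
          mult _≼_ O σ′T v + mult _≼_ O τ′T v
            ≡⟨ cong₂ _+_ (mult-tableau≡∑∈ σ′ σ′-positive σ′-compatible v)
                         (mult-tableau≡∑∈ τ′ τ′-positive τ′-compatible v) ⟩
          ∑∈ M σ′-hit + ∑∈ U τ′-hit
            ≡⟨ cong (_+ ∑∈ U τ′-hit) (∑∈-⊆ uM uU M⊆U M? σ′-hit) ⟩
          ∑∈ U (λ u → onlyIf (M? u) σ′-hit) + ∑∈ U τ′-hit
            ≡⟨ ∑-distrib-+ (λ k → onlyIf (M? (∈-lookup k)) σ′-hit) (λ k → τ′-hit (∈-lookup k)) ⟨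
          ∑∈ U (λ u → onlyIf (M? u) σ′-hit + τ′-hit u)
            ≡⟨ sum-cong-≗ (λ k → content-at (∈-lookup k) (region (∈-lookup k))) ⟩
          ∑∈ U (λ u → onlyIf (I? u) σ-hit + onlyIf (J? u) τ-hit)
            ≡⟨ ∑-distrib-+ (λ k → onlyIf (I? (∈-lookup k)) σ-hit)
                           (λ k → onlyIf (J? (∈-lookup k)) τ-hit) ⟩
          ∑∈ U (λ u → onlyIf (I? u) σ-hit) + ∑∈ U (λ u → onlyIf (J? u) τ-hit)
            ≡⟨ cong₂ _+_ (∑∈-⊆ uI uU I⊆U I? σ-hit) (∑∈-⊆ uJ uU J⊆U J? τ-hit) ⟨
          ∑∈ I σ-hit + ∑∈ J τ-hit
            ≡⟨ cong₂ _+_ (mult≡∑∈ σT v) (mult≡∑∈ τT v) ⟨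
          mult _≼_ O σT v + mult _≼_ O τT v ∎

      ρ′ : Filling I
      ρ′ a = τ′ (I⊆U a)

      swapped-values : ∀ {x} (m : x ∈ M) → R x → valuesAt ρ′ σ′ m ≡ valuesAt σ τM m
      swapped-values m r = cong₂ _,_ (τ′-σ (M⊆U m) (M⊆I m) (inj₂ r)) (σ′-τ m (M⊆J m) r)

      kept-values : ∀ {x} (m : x ∈ M) → ¬ R x → valuesAt ρ′ σ′ m ≡ swap (valuesAt σ τM m)
      kept-values m ¬r = cong₂ _,_ (τ′-τ (M⊆U m) (M⊆J m) (inj₂ ¬r)) (σ′-σ m (M⊆I m) ¬r)

      no-clash-swapped-kept : ∀ {x y} (m : x ∈ M) (m′ : y ∈ M) (c : x ⋖ y) →
                              ¬ Clash c (valuesAt σ τM m) (swap (valuesAt σ τM m′))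
      no-clash-swapped-kept m m′ c =
        [ (λ σ≰σ → σ≰σ (σ-compatible (M⊆I m) (M⊆I m′) c))
        , (λ τ≰τ → τ≰τ (τ-compatible (M⊆J m) (M⊆J m′) c)) ]′

      no-clash-kept-swapped : ∀ {x y} (m : x ∈ M) (m′ : y ∈ M) (c : x ⋖ y) →
                              ¬ Clash c (swap (valuesAt σ τM m)) (valuesAt σ τM m′)
      no-clash-kept-swapped m m′ c =
        [ (λ τ≰τ → τ≰τ (τ-compatible (M⊆J m) (M⊆J m′) c))
        , (λ σ≰σ → σ≰σ (σ-compatible (M⊆I m) (M⊆I m′) c)) ]′

      R⊆SwapRegionOfImage : ∀ {x} → R x → SwapRegionOfImage σ′ τ′ x
      R⊆SwapRegionOfImage = MustSwap-transfer swapped-values (λ a t∉J → τ′-σ (I⊆U a) a (inj₁ t∉J))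

      -- Across a cover from R to its complement the exchanged pair carries σ at both ends
      -- or τ at both ends, and these never clash.
      SwapRegionOfImage⊆R : ∀ {x} → SwapRegionOfImage σ′ τ′ x → R x
      SwapRegionOfImage⊆R (boundary m a t∉J c σ≰σ) = decidable-stable (R? m) λ ¬r →
        σ≰σ (subst₂ _≤[ c ]_ (sym (σ′-σ m (M⊆I m) ¬r)) (sym (τ′-σ (I⊆U a) a (inj₁ t∉J)))
                     (σ-compatible (M⊆I m) a c))
      SwapRegionOfImage⊆R (up m m′ c clash r) = decidable-stable (R? m′) λ ¬r′ →
        no-clash-swapped-kept m m′ c
          (subst₂ (Clash c) (swapped-values m (SwapRegionOfImage⊆R r)) (kept-values m′ ¬r′) clash)
      SwapRegionOfImage⊆R (down m m′ c clash r) = decidable-stable (R? m) λ ¬r →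
        no-clash-kept-swapped m m′ c
          (subst₂ (Clash c) (kept-values m ¬r) (swapped-values m′ (SwapRegionOfImage⊆R r)) clash)

    exchange : ∀ {α} (p : ProductTerm _≼_ O I J α) → DecidableOn M (SwapRegionOf p) →
               ProductTerm _≼_ O M U α
    exchange (pair σT τT content) R? =
      pair σ′T τ′T λ i 1≤i → trans (exchange-preserves-content i) (content i 1≤i)
      where open Exchange σT τT R?

    module Compare
      (σT₁ : Tableau _≼_ O I) (τT₁ : Tableau _≼_ O J) (R₁? : DecidableOn M (SwapRegion σT₁ τT₁))
      (σT₂ : Tableau _≼_ O I) (τT₂ : Tableau _≼_ O J) (R₂? : DecidableOn M (SwapRegion σT₂ τT₂))
      (σ′T≡ : Exchange.σ′T σT₁ τT₁ R₁? ≡ Exchange.σ′T σT₂ τT₂ R₂?)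
      (τ′T≡ : Exchange.τ′T σT₁ τT₁ R₁? ≡ Exchange.τ′T σT₂ τT₂ R₂?) where

      module E₁ = Exchange σT₁ τT₁ R₁?
      module E₂ = Exchange σT₂ τT₂ R₂?

      σ′≐ : E₁.σ′ ≐ E₂.σ′
      σ′≐ = tableau-injective {g⁺ = E₁.σ′-positive} {E₁.σ′-compatible}
                              {E₂.σ′-positive} {E₂.σ′-compatible} uM σ′T≡

      τ′≐ : E₁.τ′ ≐ E₂.τ′
      τ′≐ = tableau-injective {g⁺ = E₁.τ′-positive} {E₁.τ′-compatible}
                              {E₂.τ′-positive} {E₂.τ′-compatible} uU τ′T≡

      R₁⊆R₂ : ∀ {x} → E₁.R x → E₂.R x
      R₁⊆R₂ = E₂.SwapRegionOfImage⊆R ∘ SwapRegionOfImage-cong σ′≐ τ′≐ ∘ E₁.R⊆SwapRegionOfImage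

      R₂⊆R₁ : ∀ {x} → E₂.R x → E₁.R x
      R₂⊆R₁ = E₁.SwapRegionOfImage⊆R ∘ SwapRegionOfImage-cong (sym ∘ σ′≐) (sym ∘ τ′≐)
                                    ∘ E₂.R⊆SwapRegionOfImage

      σ-via-τ′ : ∀ {x} (a : x ∈ I) → x ∉ J ⊎ E₁.R x → x ∉ J ⊎ E₂.R x → E₁.σ a ≡ E₂.σ a
      σ-via-τ′ a side₁ side₂ =
        trans (sym (E₁.τ′-σ (I⊆U a) a side₁)) (trans (τ′≐ (I⊆U a)) (E₂.τ′-σ (I⊆U a) a side₂))

      σ-via-σ′ : ∀ {x} (m : x ∈ M) (a : x ∈ I) → ¬ E₁.R x → ¬ E₂.R x → E₁.σ a ≡ E₂.σ a
      σ-via-σ′ m a ¬r₁ ¬r₂ = trans (sym (E₁.σ′-σ m a ¬r₁)) (trans (σ′≐ m) (E₂.σ′-σ m a ¬r₂))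

      τ-via-τ′ : ∀ {x} (b : x ∈ J) → x ∉ I ⊎ ¬ E₁.R x → x ∉ I ⊎ ¬ E₂.R x → E₁.τ b ≡ E₂.τ b
      τ-via-τ′ b side₁ side₂ =
        trans (sym (E₁.τ′-τ (J⊆U b) b side₁)) (trans (τ′≐ (J⊆U b)) (E₂.τ′-τ (J⊆U b) b side₂))

      τ-via-σ′ : ∀ {x} (m : x ∈ M) (b : x ∈ J) → E₁.R x → E₂.R x → E₁.τ b ≡ E₂.τ b
      τ-via-σ′ m b r₁ r₂ = trans (sym (E₁.σ′-τ m b r₁)) (trans (σ′≐ m) (E₂.σ′-τ m b r₂))

      σ-at : ∀ {x} → Region E₁.R x → (a : x ∈ I) → E₁.σ a ≡ E₂.σ a
      σ-at (swapped m r)  a = σ-via-τ′ a (inj₂ r) (inj₂ (R₁⊆R₂ r))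
      σ-at (kept m ¬r)    a = σ-via-σ′ m a ¬r (¬r ∘ R₂⊆R₁)
      σ-at (onlyI _ x∉J)  a = σ-via-τ′ a (inj₁ x∉J) (inj₁ x∉J)
      σ-at (onlyJ _ x∉I)  a = ⊥-elim (x∉I a)

      τ-at : ∀ {x} → Region E₁.R x → (b : x ∈ J) → E₁.τ b ≡ E₂.τ b
      τ-at (swapped m r)  b = τ-via-σ′ m b r (R₁⊆R₂ r)
      τ-at (kept m ¬r)    b = τ-via-τ′ b (inj₂ ¬r) (inj₂ (¬r ∘ R₂⊆R₁))
      τ-at (onlyI _ x∉J)  b = ⊥-elim (x∉J b)
      τ-at (onlyJ _ x∉I)  b = τ-via-τ′ b (inj₁ x∉I) (inj₁ x∉I)

      tableaux-determined : σT₁ ≡ σT₂ × τT₁ ≡ τT₂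
      tableaux-determined = value-injective σT₁ σT₂ (λ a → σ-at (E₁.region (I⊆U a)) a)
                          , value-injective τT₁ τT₂ (λ b → τ-at (E₁.region (J⊆U b)) b)

    exchange-injective : ∀ {α} (p q : ProductTerm _≼_ O I J α)
      (Rp? : DecidableOn M (SwapRegionOf p)) (Rq? : DecidableOn M (SwapRegionOf q)) →
      exchange p Rp? ≡ exchange q Rq? → p ≡ q
    exchange-injective (pair σT₁ τT₁ _) (pair σT₂ τT₂ _) R₁? R₂? same
      with refl , refl ← Compare.tableaux-determined σT₁ τT₁ R₁? σT₂ τT₂ R₂?
                           (cong ProductTerm.left same) (cong ProductTerm.right same) = refl

    exchange-injection : ∀ {α} → (∀ p → DecidableOn M (SwapRegionOf p)) →
                         ProductTerm _≼_ O I J α ↣ ProductTerm _≼_ O M U α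
    exchange-injection R? = mk↣ λ {p} {q} → exchange-injective p q (R? p) (R? q)

mainTheorem8 : {X : Set} (_≼_ : X → X → Set) →
    IsPartialOrder _≡_ _≼_ → LocallyFinite _≼_ →
    (O : Labelling _≼_) →
    (I J : List X) → Unique I → Unique J →
    IsOrderIdeal _≼_ I → IsOrderIdeal _≼_ J →
    (M U : List X) → Unique M → Unique U →
    (∀ x → (x ∈ M) ⇔ (x ∈ I × x ∈ J)) →
    (∀ x → (x ∈ U) ⇔ (x ∈ I ⊎ x ∈ J)) →
    ∀ (α : ℕ → ℕ) (n m : ℕ) →
    ProductCoeff _≼_ O I J α n → ProductCoeff _≼_ O M U α m → n ≤ m
mainTheorem8 _≼_ _ _ O I J uI uJ I-ideal J-ideal M U uM uU M⇔I∩J U⇔I∪J α n m IJ↔n MU↔m =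
  decidable-stable (n ≤? m) λ n≰m →
  ¬¬-decidableOn U (_∈ I) λ I? →
  ¬¬-decidableOn U (_∈ J) λ J? →
  ¬¬-∀-finite IJ↔n (λ p → ¬¬-decidableOn M (SwapRegionOf p)) λ R? →
  n≰m (↣⇒≤ IJ↔n MU↔m (exchange-injection I? J? R?))
  where open Swap _≼_ O I J M U uI uJ uM uU I-ideal J-ideal M⇔I∩J U⇔I∪J
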